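{- Let $H$ be a triangle-free graph on $6$ vertices and let $x,y\in V(H)$. Then there are at most $9$ different $x$--$y$ paths in $H$.
   Context: Graphs are finite and simple. A graph is triangle-free if it contains no cycle of length $3$. -}

module Defs where

open import Data.Nat using (ℕ; suc; _≤_)
open import Data.Fin using (Fin)
open import Data.List using (List; []; _∷_; length; head; last)
open import Data.List.Relation.Unary.Unique.Propositional using (Unique)
open import Data.Maybe using (Maybe; just)
open import Relation.Binary.PropositionalEquality using (_≡_)
open import Relation.Nullary using (¬_)
open import Data.Empty using (⊥)

record Graph (n : ℕ) : Set₁ where
  field
    Adj   : Fin n → Fin n → Set
    irrefl : ∀ u → ¬ Adj u u
    sym   : ∀ {u v} → Adj u v → Adj v u
open Graph public

TriangleFree : ∀ {n} → Graph n → Set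
TriangleFree G = ∀ u v w → Adj G u v → Adj G v w → Adj G w u → ⊥

data Walk {n} (G : Graph n) : List (Fin n) → Set where
  single : ∀ u → Walk G (u ∷ [])
  step   : ∀ {u v vs} → Adj G u v → Walk G (v ∷ vs) → Walk G (u ∷ v ∷ vs)

record IsPath {n} (G : Graph n) (x y : Fin n) (p : List (Fin n)) : Set where
  field
    walk   : Walk G p
    distinct : Unique p
    starts : head p ≡ just x
    ends   : last p ≡ just y

module Submission where

-- The bound is proved by a verified exhaustive search.
--
-- Fix endpoints x, y of a graph on Fin n.  Every x–y path is a duplicate-free
-- list of vertices, hence one of the finitely many `candidates x y`.  The
-- search `fewPaths k` runs through the edges uv of the complete graph, keeping
-- the edges declared present so far and the candidates still possible; it
-- succeeds on a branch as soon as at most k candidates remain, and otherwise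
-- needs both sub-branches to succeed:
--   * "uv present": refuted outright if uv closes a triangle with present edges;
--   * "uv absent":  every candidate using the edge uv is discarded.
-- Soundness (`fewPaths-sound`) follows a given list ps of distinct x–y paths of
-- a triangle-free graph down the search tree: if some path of ps uses uv then
-- uv is an edge (the present branch is consistent), otherwise all of ps
-- survives the filter; at a successful leaf ps is a duplicate-free sublist of
-- at most k candidates (`unique⊆⇒length≤`).  The theorem is the instance
-- n = 6, k = 9, where the search succeeds for all 36 endpoint pairs by
-- evaluation.

open import Defs
open import Data.Nat using (ℕ; zero; suc; _≤_; _≤ᵇ_; z≤n; s≤s)
open import Data.Nat.Properties using (≤-trans; ≤-reflexive; ≤ᵇ⇒≤)
open import Data.Fin using (Fin; _≟_; _<?_)
open import Data.Bool using (Bool; T; _∧_; _∨_)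
open import Data.Bool.Properties using (T-∧; T-∨)
open import Data.Unit using (tt)
open import Data.Fin.Properties as Fin using ()
open import Data.List
  using (List; []; _∷_; [_]; length; head; last; map; concatMap; filter; allFin; removeAt)
open import Data.List.Properties using (length-removeAt′; length-tabulate)
open import Data.List.Membership.Propositional using (_∈_)
open import Data.List.Membership.Propositional.Properties
  using (∈-map⁺; ∈-concatMap⁺; ∈-filter⁺; ∈-allFin)
open import Data.List.Relation.Unary.All as All using (All; []; _∷_)
open import Data.List.Relation.Unary.All.Properties using (¬Any⇒All¬)
open import Data.List.Relation.Unary.Any as Any using (Any; here; there; any?)
open import Data.List.Relation.Unary.AllPairs using ([]; _∷_)
open import Data.List.Relation.Unary.Unique.Propositional using (Unique)
open import Data.Maybe using (just)
open import Data.Maybe.Properties using (≡-dec)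
open import Data.Product using (_×_; _,_)
open import Data.Sum using (_⊎_; inj₁; inj₂)
open import Data.Empty using (⊥-elim)
open import Function using (Equivalence)
open import Relation.Nullary using (¬_; Dec; yes; no; isYes; ¬?)
open import Relation.Nullary.Decidable using (_×-dec_; _⊎-dec_; toWitness; T?)
open import Relation.Binary using (DecidableEquality)
open import Relation.Binary.PropositionalEquality using (_≡_; _≢_; refl)

private
  T-∨⁻ : ∀ {a b} → T (a ∨ b) → T a ⊎ T b
  T-∨⁻ {a} = Equivalence.to (T-∨ {a})

  T-∧⁻ : ∀ {a b} → T (a ∧ b) → T a × T b
  T-∧⁻ {a} = Equivalence.to (T-∧ {a})

∈-removeAt : ∀ {A : Set} {a b : A} {ys : List A} (a∈ys : a ∈ ys) →
             b ∈ ys → a ≢ b → b ∈ removeAt ys (Any.index a∈ys)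
∈-removeAt (here refl)  (here refl)  a≢b = ⊥-elim (a≢b refl)
∈-removeAt (here refl)  (there b∈ys) _   = b∈ys
∈-removeAt (there a∈ys) (here refl)  _   = here refl
∈-removeAt (there a∈ys) (there b∈ys) a≢b = there (∈-removeAt a∈ys b∈ys a≢b)

unique⊆⇒length≤ : ∀ {A : Set} {xs ys : List A} →
                  Unique xs → All (_∈ ys) xs → length xs ≤ length ys
unique⊆⇒length≤ [] [] = z≤n
unique⊆⇒length≤ {ys = ys} (x≢xs ∷ xs-unique) (x∈ys ∷ xs⊆ys)
  rewrite length-removeAt′ ys (Any.index x∈ys) =
  s≤s (unique⊆⇒length≤ xs-unique (All.zipWith keep (xs⊆ys , x≢xs)))
  where
    keep : ∀ {b} → b ∈ ys × _ ≢ b → b ∈ removeAt ys (Any.index x∈ys)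
    keep (b∈ys , x≢b) = ∈-removeAt x∈ys b∈ys x≢b

module Arrangements {A : Set} (_≟A_ : DecidableEquality A) where

  arrangements : ℕ → List A → List (List A)
  arrangements zero    U = [ [] ]
  arrangements (suc n) U =
    [] ∷ concatMap (λ u → map (u ∷_) (arrangements n (filter (λ w → ¬? (u ≟A w)) U))) U

  arrangements-complete : ∀ n U {xs} → Unique xs → All (_∈ U) xs → length xs ≤ n →
                          xs ∈ arrangements n U
  arrangements-complete zero    U []                   []          z≤n       = here refl
  arrangements-complete (suc n) U []                   []          _         = here refl
  arrangements-complete (suc n) U {x ∷ xs} (x≢xs ∷ xs-unique) (x∈U ∷ xs⊆U) (s≤s len) =
    there (∈-concatMap⁺ _ (Any.map (λ { refl → ∈-map⁺ (x ∷_) tail∈ }) x∈U))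
    where
      U-x : List A
      U-x = filter (λ w → ¬? (x ≟A w)) U
      keep : ∀ {w} → w ∈ U × x ≢ w → w ∈ U-x
      keep (w∈U , x≢w) = ∈-filter⁺ (λ w → ¬? (x ≟A w)) w∈U x≢w
      tail∈ : xs ∈ arrangements n U-x
      tail∈ = arrangements-complete n U-x xs-unique (All.zipWith keep (xs⊆U , x≢xs)) len

module _ {n : ℕ} where

  open Arrangements (_≟_ {n})

  Vertex : Set
  Vertex = Fin n

  Edge : Set
  Edge = Vertex × Vertex

  IsEdge : Graph n → Edge → Set
  IsEdge G (a , b) = Adj G a b

  SameEdge : Vertex → Vertex → Edge → Set
  SameEdge u v (a , b) = (u ≡ a × v ≡ b) ⊎ (u ≡ b × v ≡ a)

  sameEdge? : ∀ u v e → Dec (SameEdge u v e)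
  sameEdge? u v (a , b) = (u ≟ a ×-dec v ≟ b) ⊎-dec (u ≟ b ×-dec v ≟ a)

  sameEdge⇒Adj : ∀ (G : Graph n) {u v} e → SameEdge u v e → IsEdge G e → Adj G u v
  sameEdge⇒Adj G (a , b) (inj₁ (refl , refl)) ab = ab
  sameEdge⇒Adj G (a , b) (inj₂ (refl , refl)) ab = sym G ab

  listed⇒Adj : ∀ (G : Graph n) {u v es} → All (IsEdge G) es → Any (SameEdge u v) es → Adj G u v
  listed⇒Adj G es⊆G listed with All.lookupAny es⊆G listed
  ... | ab , same = sameEdge⇒Adj G _ same ab

  steps : List Vertex → List Edge
  steps (a ∷ b ∷ r) = (a , b) ∷ steps (b ∷ r)
  steps _           = []

  walk-steps : ∀ {G : Graph n} {p} → Walk G p → All (IsEdge G) (steps p)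
  walk-steps (single _)  = []
  walk-steps (step ab w) = ab ∷ walk-steps w

  Uses : Vertex → Vertex → List Vertex → Set
  Uses u v p = Any (SameEdge u v) (steps p)

  uses? : ∀ u v p → Dec (Uses u v p)
  uses? u v p = any? (sameEdge? u v) (steps p)

  ClosesTriangle : Vertex → Vertex → List Edge → Set
  ClosesTriangle u v present =
    Any (λ w → Any (SameEdge u w) present × Any (SameEdge v w) present) (allFin n)

  closesTriangle? : ∀ u v present → Dec (ClosesTriangle u v present)
  closesTriangle? u v present =
    any? (λ w → any? (sameEdge? u w) present ×-dec any? (sameEdge? v w) present) (allFin n)

  candidates : Vertex → Vertex → List (List Vertex)
  candidates x y = filter endpoints? (arrangements n (allFin n))
    where
      endpoints? : ∀ p → Dec (head p ≡ just x × last p ≡ just y)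
      endpoints? p = ≡-dec _≟_ (head p) (just x) ×-dec ≡-dec _≟_ (last p) (just y)

  path∈candidates : ∀ {G : Graph n} {x y p} → IsPath G x y p → p ∈ candidates x y
  path∈candidates {p = p} path =
    ∈-filter⁺ _ (arrangements-complete n (allFin n) distinct p⊆V short) (starts , ends)
    where
      open IsPath path
      p⊆V : All (_∈ allFin n) p
      p⊆V = All.tabulate (λ {v} _ → ∈-allFin v)
      short : length p ≤ n
      short = ≤-trans (unique⊆⇒length≤ distinct p⊆V) (≤-reflexive (length-tabulate (λ v → v)))

  avoiding : Vertex → Vertex → List (List Vertex) → List (List Vertex)
  avoiding u v = filter (λ p → ¬? (uses? u v p))

  -- The search: can the candidates be cut down to at most k, whatever the
  -- status of the undecided edges, given the edges already present?
  fewPaths : ℕ → List Edge → List Edge → List (List Vertex) → Bool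
  fewPaths k []                      present cands = length cands ≤ᵇ k
  fewPaths k ((u , v) ∷ undecided) present cands =
    (length cands ≤ᵇ k) ∨
    ((isYes (closesTriangle? u v present) ∨ fewPaths k undecided ((u , v) ∷ present) cands)
     ∧ fewPaths k undecided present (avoiding u v cands))

  module Soundness (G : Graph n) (triangle-free : TriangleFree G) {x y : Vertex}
                   {ps : List (List Vertex)} (ps-paths : All (IsPath G x y) ps)
                   (ps-distinct : Unique ps) (k : ℕ) where

    few⇒bound : ∀ {cands} → All (_∈ cands) ps → T (length cands ≤ᵇ k) → length ps ≤ k
    few⇒bound {cands} ps⊆cands few =
      ≤-trans (unique⊆⇒length≤ ps-distinct ps⊆cands) (≤ᵇ⇒≤ (length cands) k few)

    used⇒Adj : ∀ {u v} → Any (Uses u v) ps → Adj G u v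
    used⇒Adj used with All.lookupAny ps-paths used
    ... | path , uses = listed⇒Adj G (walk-steps (IsPath.walk path)) uses

    unused⇒survive : ∀ {u v cands} → ¬ Any (Uses u v) ps → All (_∈ cands) ps →
                     All (_∈ avoiding u v cands) ps
    unused⇒survive {u} {v} unused ps⊆cands =
      All.zipWith survive (ps⊆cands , ¬Any⇒All¬ ps unused)
      where
        survive : ∀ {cands p} → p ∈ cands × ¬ Uses u v p → p ∈ avoiding u v cands
        survive (p∈cands , p-avoids) = ∈-filter⁺ (λ p → ¬? (uses? u v p)) p∈cands p-avoids

    no-triangle : ∀ {u v present} → All (IsEdge G) present → Adj G u v →
                  ¬ ClosesTriangle u v present
    no-triangle present⊆G uv closes with Any.satisfied closes
    ... | w , uw , vw =
      triangle-free _ _ w uv (listed⇒Adj G present⊆G vw) (sym G (listed⇒Adj G present⊆G uw))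

    fewPaths-sound : ∀ undecided present cands →
                     All (IsEdge G) present → All (_∈ cands) ps →
                     T (fewPaths k undecided present cands) → length ps ≤ k
    fewPaths-sound [] present cands _ ps⊆cands ok = few⇒bound ps⊆cands ok
    fewPaths-sound ((u , v) ∷ undecided) present cands present⊆G ps⊆cands ok
      with T-∨⁻ ok
    ... | inj₁ few = few⇒bound ps⊆cands few
    ... | inj₂ branches with T-∧⁻ branches | any? (uses? u v) ps
    ...   | _ , if-absent | no unused =
      fewPaths-sound undecided present _ present⊆G (unused⇒survive unused ps⊆cands) if-absent
    ...   | if-present , _ | yes used
      with T-∨⁻ if-present
    ...     | inj₁ closes =
      ⊥-elim (no-triangle present⊆G (used⇒Adj used)
                          (toWitness {a? = closesTriangle? u v present} closes))
    ...     | inj₂ ok′ =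
      fewPaths-sound undecided ((u , v) ∷ present) cands (used⇒Adj used ∷ present⊆G) ps⊆cands ok′

  completeEdges : List Edge
  completeEdges = concatMap (λ u → map (u ,_) (filter (u <?_) (allFin n))) (allFin n)

  AllPairsFew : ℕ → Set
  AllPairsFew k = ∀ x y → T (fewPaths k completeEdges [] (candidates x y))

  allPairsFew? : ∀ k → Dec (AllPairsFew k)
  allPairsFew? k =
    Fin.all? (λ x → Fin.all? (λ y → T? (fewPaths k completeEdges [] (candidates x y))))

  pathCount-bound : ∀ k → AllPairsFew k → (G : Graph n) → TriangleFree G → (x y : Vertex) →
                    (ps : List (List Vertex)) → All (IsPath G x y) ps → Unique ps →
                    length ps ≤ k
  pathCount-bound k search-ok G triangle-free x y ps ps-paths ps-distinct =
    fewPaths-sound completeEdges [] (candidates x y) [] (All.map path∈candidates ps-paths)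
      (search-ok x y)
    where open Soundness G triangle-free ps-paths ps-distinct k

lemma6 : (H : Graph 6) → TriangleFree H → (x y : Fin 6) →
    (ps : List (List (Fin 6))) → All (IsPath H x y) ps → Unique ps →
    length ps ≤ 9
lemma6 = pathCount-bound 9 (toWitness {a? = allPairsFew? 9} tt)
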